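{- Let $n\ge0$ and $k\ge1$ be integers. There is a bijection between the set $\mathcal{CS}_{n+k,k}$ and the set of Schröder paths from $(0,0)$ to $(n+k-1,n+k-1)$ having exactly $k-1$ diagonal steps on the line $y=x$.
   Context: A Schröder path is a lattice path with steps $\mathsf{E}=(1,0)$, $\mathsf{N}=(0,1)$, $\mathsf{D}=(1,1)$ staying weakly above the line $y=x$. The little Schröder number $s_m$ ($m\ge0$) is the number of Schröder paths from $(0,0)$ to $(m,m)$ with no $\mathsf{D}$-step on $y=x$. $\mathcal{CS}_{N,k}$ denotes the set of compositions of $N$ into exactly $k$ (positive) parts in which each part equal to $j$ is given one of $s_{j-1}$ colors. -}

module Defs where

open import Data.Bool using (Bool; true; false; _∧_; T; if_then_else_)
open import Data.Nat using (ℕ; zero; suc; _+_; _∸_; _≤_; _≡ᵇ_; _≤ᵇ_)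
open import Data.List using (List; []; _∷_; length; filterᵇ; concatMap; map; upTo)
open import Data.Vec using (Vec)
import Data.Vec as Vec
open import Data.Fin using (Fin)
open import Data.Product using (Σ; _×_; proj₁)
open import Relation.Binary.PropositionalEquality using (_≡_)

-- Lattice steps: E = (1,0), N = (0,1), D = (1,1).
data Step : Set where
  E N D : Step

-- validFrom m x y p : the step sequence p, started at the point (x,y),
-- stays weakly above the line y = x (every visited point satisfies x ≤ y)
-- and ends at (m,m).  (The starting point is assumed to satisfy x ≤ y;
-- N and D steps preserve x ≤ y, so only E steps need checking.)
validFrom : ℕ → ℕ → ℕ → List Step → Bool
validFrom m x y []      = (x ≡ᵇ m) ∧ (y ≡ᵇ m)
validFrom m x y (E ∷ p) = (suc x ≤ᵇ y) ∧ validFrom m (suc x) y p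
validFrom m x y (N ∷ p) = validFrom m x (suc y) p
validFrom m x y (D ∷ p) = validFrom m (suc x) (suc y) p

diagDFrom : ℕ → ℕ → List Step → ℕ
diagDFrom x y []      = 0
diagDFrom x y (E ∷ p) = diagDFrom (suc x) y p
diagDFrom x y (N ∷ p) = diagDFrom x (suc y) p
diagDFrom x y (D ∷ p) = (if x ≡ᵇ y then 1 else 0) + diagDFrom (suc x) (suc y) p

SchroderPath : ℕ → Set
SchroderPath m = Σ (List Step) (λ p → T (validFrom m 0 0 p))

diagD : ∀ {m} → SchroderPath m → ℕ
diagD p = diagDFrom 0 0 (proj₁ p)

words : ℕ → List (List Step)
words zero    = [] ∷ []
words (suc L) = concatMap (λ w → (E ∷ w) ∷ (N ∷ w) ∷ (D ∷ w) ∷ []) (words L)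

wordsUpTo : ℕ → List (List Step)
wordsUpTo L = concatMap words (upTo (suc L))

-- Little Schröder number s_m: the number of Schröder paths from (0,0) to (m,m)
-- with no D-step on y = x.  Such a path has at most 2m steps, so it suffices
-- to count among words of length ≤ 2m.
s : ℕ → ℕ
s m = length (filterᵇ (λ p → validFrom m 0 0 p ∧ (diagDFrom 0 0 p ≡ᵇ 0)) (wordsUpTo (m + m)))

ColouredPart : Set
ColouredPart = Σ ℕ (λ j → (1 ≤ j) × Fin (s (j ∸ 1)))

CS : ℕ → ℕ → Set
CS n k = Σ (Vec ColouredPart k) (λ c → Vec.sum (Vec.map proj₁ c) ≡ n)

-- Call a Schröder path primitive if it has no D-step on the line y = x; by
-- definition, s m counts the primitive paths of size m.  The bijection sends a
-- coloured composition (j₁, …, j_k) of N to the path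
--     π₁ D π₂ D ⋯ D π_k,
-- where π_i is the primitive path of size j_i − 1 singled out by the colour of
-- j_i.  This path has size Σ (j_i − 1) + (k − 1) = N − 1 and its diagonal
-- D-steps are exactly the k − 1 displayed ones.  Conversely, cutting a path at
-- its diagonal D-steps recovers the primitive pieces uniquely.
module Submission where

open import Defs
open import Data.Bool using (Bool; true; false; _∧_; T; if_then_else_)
open import Data.Bool.Properties using (T-∧; T-irrelevant)
open import Data.Empty using (⊥)
open import Data.Fin using (Fin)
import Data.Fin as Fin
open import Data.List using (List; []; _∷_; _++_; length; lookup; concatMap; filterᵇ)
open import Data.List.Properties using (∷-injective)
open import Data.List.Membership.Propositional using (_∈_; find; lose)
open import Data.List.Membership.Propositional.Properties
  using (∈-concatMap⁺; ∈-concatMap⁻; ∈-upTo⁺; ∈-filter⁺; ∈-filter⁻; ∈-lookup)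
open import Data.List.Relation.Unary.Any using (here; there; index)
open import Data.List.Relation.Unary.Any.Properties using (lookup-index)
import Data.List.Relation.Unary.All as All
import Data.List.Relation.Unary.All.Properties as All
open import Data.List.Relation.Unary.AllPairs using ([]; _∷_)
import Data.List.Relation.Unary.AllPairs as AllPairs
import Data.List.Relation.Unary.AllPairs.Properties as AllPairs
open import Data.List.Relation.Unary.Unique.Propositional using (Unique)
import Data.List.Relation.Unary.Unique.Propositional.Properties as Unique
open import Data.List.Relation.Binary.Disjoint.Propositional using (Disjoint)
open import Data.Nat using (ℕ; zero; suc; _+_; _∸_; _≤_; _≡ᵇ_; _≤ᵇ_; z≤n; s≤s)
open import Data.Nat.Properties
  using (≡ᵇ⇒≡; ≡⇒≡ᵇ; suc-injective; +-suc; +-identityʳ; ≤-reflexive; ≤-trans; n≤1+n; m+[n∸m]≡n;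
         +-assoc; ≡-irrelevant)
open import Data.Product using (Σ; _×_; _,_; proj₁; proj₂; ∃)
open import Data.Sum using (_⊎_; inj₁; inj₂)
open import Data.Vec using (Vec; []; _∷_)
import Data.Vec as Vec
open import Function using (_∘_)
open import Function.Bundles using (_⤖_; mk⤖; Equivalence)
open import Function.Definitions using (Injective; Surjective)
open import Relation.Binary.PropositionalEquality
open import Relation.Nullary.Decidable using (T?)
open ≡-Reasoning

∧-split : ∀ {a b} → T (a ∧ b) → T a × T b
∧-split = Equivalence.to T-∧

∧-join : ∀ {a b} → T a → T b → T (a ∧ b)
∧-join ta tb = Equivalence.from T-∧ (ta , tb)

-- Part 1.  Algebra of step sequences.

atEnd : ∀ m x y → T (validFrom m x y []) → x ≡ m × y ≡ m
atEnd m x y t with tx , ty ← ∧-split t = ≡ᵇ⇒≡ x m tx , ≡ᵇ⇒≡ y m ty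

≡ᵇ-shift : ∀ a u v → (a + u ≡ᵇ a + v) ≡ (u ≡ᵇ v)
≡ᵇ-shift zero    u v = refl
≡ᵇ-shift (suc a) u v = ≡ᵇ-shift a u v

≤ᵇ-shift : ∀ a u v → (suc (a + u) ≤ᵇ a + v) ≡ (suc u ≤ᵇ v)
≤ᵇ-shift zero    u v = refl
≤ᵇ-shift (suc a) u v = ≤ᵇ-shift a u v

≡ᵇ-refl : ∀ a → (a ≡ᵇ a) ≡ true
≡ᵇ-refl zero    = refl
≡ᵇ-refl (suc a) = ≡ᵇ-refl a

shift-validity : ∀ a m x y p → validFrom (a + m) (a + x) (a + y) p ≡ validFrom m x y p
shift-validity a m x y []      rewrite ≡ᵇ-shift a x m | ≡ᵇ-shift a y m = refl
shift-validity a m x y (E ∷ p) rewrite ≤ᵇ-shift a x y | sym (+-suc a x)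
                                     | shift-validity a m (suc x) y p = refl
shift-validity a m x y (N ∷ p) rewrite sym (+-suc a y) = shift-validity a m x (suc y) p
shift-validity a m x y (D ∷ p) rewrite sym (+-suc a x) | sym (+-suc a y) =
  shift-validity a m (suc x) (suc y) p

shift-diagonals : ∀ a x y p → diagDFrom (a + x) (a + y) p ≡ diagDFrom x y p
shift-diagonals a x y []      = refl
shift-diagonals a x y (E ∷ p) rewrite sym (+-suc a x) = shift-diagonals a (suc x) y p
shift-diagonals a x y (N ∷ p) rewrite sym (+-suc a y) = shift-diagonals a x (suc y) p
shift-diagonals a x y (D ∷ p) rewrite ≡ᵇ-shift a x y | sym (+-suc a x) | sym (+-suc a y)
                                    | shift-diagonals a (suc x) (suc y) p = refl

++-validity : ∀ {m m' x y} w {r} → T (validFrom m' x y w) →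
              validFrom m x y (w ++ r) ≡ validFrom m m' m' r
++-validity {m' = m'} {x} {y} [] t with refl , refl ← atEnd m' x y t = refl
++-validity {x = x} {y} (E ∷ w) t with suc x ≤ᵇ y
... | true = ++-validity w t
++-validity (N ∷ w) t = ++-validity w t
++-validity (D ∷ w) t = ++-validity w t

++-diagonals : ∀ {m' x y} w {r} → T (validFrom m' x y w) →
               diagDFrom x y (w ++ r) ≡ diagDFrom x y w + diagDFrom m' m' r
++-diagonals {m'} {x} {y} [] t with refl , refl ← atEnd m' x y t = refl
++-diagonals (E ∷ w) t = ++-diagonals w (proj₂ (∧-split t))
++-diagonals (N ∷ w) t = ++-diagonals w t
++-diagonals {x = x} {y} (D ∷ w) {r} t rewrite ++-diagonals w {r} t =
  sym (+-assoc (if x ≡ᵇ y then 1 else 0) _ _)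

endpoint-unique : ∀ {a b x y} w → T (validFrom a x y w) → T (validFrom b x y w) → a ≡ b
endpoint-unique {a} {b} {x} {y} [] t u
  with refl , _ ← atEnd a x y t | refl , _ ← atEnd b x y u = refl
endpoint-unique (E ∷ w) t u = endpoint-unique w (proj₂ (∧-split t)) (proj₂ (∧-split u))
endpoint-unique (N ∷ w) t u = endpoint-unique w t u
endpoint-unique (D ∷ w) t u = endpoint-unique w t u

-- The height never decreases along a path, so the start lies below the end.
start≤end : ∀ {m x y} p → T (validFrom m x y p) → y ≤ m
start≤end {m} {x} {y} [] t = ≤-reflexive (proj₂ (atEnd m x y t))
start≤end (E ∷ p) t = start≤end p (proj₂ (∧-split t))
start≤end (N ∷ p) t = ≤-trans (n≤1+n _) (start≤end p t)
start≤end (D ∷ p) t = ≤-trans (n≤1+n _) (start≤end p t)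

-- Every step raises x + y by at least one, so a path from the origin to (m,m)
-- has at most 2m steps.
length-bound : ∀ {m x y} p → T (validFrom m x y p) → x + y + length p ≤ m + m
length-bound {m} {x} {y} [] t with refl , refl ← atEnd m x y t = ≤-reflexive (+-identityʳ (x + y))
length-bound {m} {x} {y} (E ∷ p) t =
  subst (_≤ m + m) (sym (+-suc (x + y) (length p))) (length-bound p (proj₂ (∧-split t)))
length-bound {m} {x} {y} (N ∷ p) t =
  subst (_≤ m + m) (trans (cong (_+ length p) (+-suc x y)) (sym (+-suc (x + y) (length p))))
        (length-bound p t)
length-bound {m} {x} {y} (D ∷ p) t =
  ≤-trans (≤-reflexive (+-suc (x + y) (length p)))
    (≤-trans (n≤1+n _)
      (subst (_≤ m + m) (cong (λ q → suc (q + length p)) (+-suc x y)) (length-bound p t)))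

D-join-validity : ∀ {a b} w {r} → T (validFrom a 0 0 w) →
                  validFrom (suc (a + b)) 0 0 (w ++ D ∷ r) ≡ validFrom b 0 0 r
D-join-validity {a} {b} w {r} t = begin
  validFrom (suc (a + b)) 0 0 (w ++ D ∷ r)           ≡⟨ ++-validity w t ⟩
  validFrom (suc a + b) (suc a) (suc a) r             ≡⟨ cong (λ c → validFrom (suc a + b) c c r) (sym (+-identityʳ (suc a))) ⟩
  validFrom (suc a + b) (suc a + 0) (suc a + 0) r     ≡⟨ shift-validity (suc a) b 0 0 r ⟩
  validFrom b 0 0 r                                   ∎

diagonal-D : ∀ a r → diagDFrom a a (D ∷ r) ≡ suc (diagDFrom 0 0 r)
diagonal-D a r rewrite ≡ᵇ-refl a = cong suc (begin
  diagDFrom (suc a) (suc a) r           ≡⟨ cong (λ c → diagDFrom c c r) (sym (+-identityʳ (suc a))) ⟩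
  diagDFrom (suc a + 0) (suc a + 0) r   ≡⟨ shift-diagonals (suc a) 0 0 r ⟩
  diagDFrom 0 0 r                       ∎)

D-join-diagonals : ∀ {a} w {r} → T (validFrom a 0 0 w) →
                   diagDFrom 0 0 (w ++ D ∷ r) ≡ diagDFrom 0 0 w + suc (diagDFrom 0 0 r)
D-join-diagonals {a} w {r} t =
  trans (++-diagonals w t) (cong (diagDFrom 0 0 w +_) (diagonal-D a r))

-- Part 2.  Enumeration of words, and colours as primitive paths.

lookup-injective : ∀ {A : Set} {xs : List A} → Unique xs →
                   ∀ i j → lookup xs i ≡ lookup xs j → i ≡ j
lookup-injective (x∉ ∷ u) Fin.zero    Fin.zero    e = refl
lookup-injective (x∉ ∷ u) Fin.zero    (Fin.suc j) e with () ← All.lookup x∉ (∈-lookup j) e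
lookup-injective (x∉ ∷ u) (Fin.suc i) Fin.zero    e with () ← All.lookup x∉ (∈-lookup i) (sym e)
lookup-injective (x∉ ∷ u) (Fin.suc i) (Fin.suc j) e = cong Fin.suc (lookup-injective u i j e)

concatMap-unique : ∀ {A B : Set} (g : A → List B) {xs : List A} → Unique xs →
                   (∀ x → Unique (g x)) → (∀ {x y} → x ≢ y → Disjoint (g x) (g y)) →
                   Unique (concatMap g xs)
concatMap-unique g {xs} u g-unique g-disjoint =
  Unique.concat⁺ (All.map⁺ (All.tabulate (λ {x} _ → g-unique x)))
                 (AllPairs.map⁺ (AllPairs.map g-disjoint u))

extensions : List Step → List (List Step)
extensions w = (E ∷ w) ∷ (N ∷ w) ∷ (D ∷ w) ∷ []

∈-extensions : ∀ {w v} → v ∈ extensions w → ∃ λ st → v ≡ st ∷ w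
∈-extensions (here refl)                 = E , refl
∈-extensions (there (here refl))         = N , refl
∈-extensions (there (there (here refl))) = D , refl

extensions-unique : ∀ w → Unique (extensions w)
extensions-unique w =
  ((λ ()) All.∷ (λ ()) All.∷ All.[]) ∷ ((λ ()) All.∷ All.[]) ∷ All.[] ∷ []

extensions-disjoint : ∀ {w w'} → w ≢ w' → Disjoint (extensions w) (extensions w')
extensions-disjoint w≢w' (v∈ , v∈')
  with _ , refl ← ∈-extensions v∈ | _ , e ← ∈-extensions v∈' = w≢w' (proj₂ (∷-injective e))

words-length : ∀ L {w} → w ∈ words L → length w ≡ L
words-length zero    (here refl) = refl
words-length (suc L) w∈ with u , u∈ , w∈ext ← find (∈-concatMap⁻ extensions {xs = words L} w∈)
                         with _ , refl ← ∈-extensions w∈ext = cong suc (words-length L u∈)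

words-complete : ∀ w → w ∈ words (length w)
words-complete []      = here refl
words-complete (E ∷ w) = ∈-concatMap⁺ extensions (lose (words-complete w) (here refl))
words-complete (N ∷ w) = ∈-concatMap⁺ extensions (lose (words-complete w) (there (here refl)))
words-complete (D ∷ w) = ∈-concatMap⁺ extensions (lose (words-complete w) (there (there (here refl))))

words-unique : ∀ L → Unique (words L)
words-unique zero    = All.[] ∷ []
words-unique (suc L) = concatMap-unique extensions (words-unique L) extensions-unique extensions-disjoint

wordsUpTo-complete : ∀ L w → length w ≤ L → w ∈ wordsUpTo L
wordsUpTo-complete L w ≤L = ∈-concatMap⁺ words (lose (∈-upTo⁺ (s≤s ≤L)) (words-complete w))

wordsUpTo-unique : ∀ L → Unique (wordsUpTo L)
wordsUpTo-unique L = concatMap-unique words (Unique.upTo⁺ (suc L)) words-unique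
  (λ {a} {b} a≢b (v∈a , v∈b) → a≢b (trans (sym (words-length a v∈a)) (words-length b v∈b)))


isPrimitive : ℕ → List Step → Bool
isPrimitive m p = validFrom m 0 0 p ∧ (diagDFrom 0 0 p ≡ᵇ 0)

record Primitive (m : ℕ) (p : List Step) : Set where
  constructor mkPrimitive
  field
    valid      : T (validFrom m 0 0 p)
    diagonals  : diagDFrom 0 0 p ≡ 0
open Primitive

isPrimitive⇒Primitive : ∀ m p → T (isPrimitive m p) → Primitive m p
isPrimitive⇒Primitive m p g with t , d ← ∧-split g = mkPrimitive t (≡ᵇ⇒≡ (diagDFrom 0 0 p) 0 d)

Primitive⇒isPrimitive : ∀ {m p} → Primitive m p → T (isPrimitive m p)
Primitive⇒isPrimitive {p = p} (mkPrimitive t d) = ∧-join t (≡⇒≡ᵇ (diagDFrom 0 0 p) 0 d)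

-- The list enumerated by  s m ; its i-th entry is the path of colour i.
primitives : ℕ → List (List Step)
primitives m = filterᵇ (isPrimitive m) (wordsUpTo (m + m))

colourPath : ∀ m → Fin (s m) → List Step
colourPath m = lookup (primitives m)

colourPath-primitive : ∀ m i → Primitive m (colourPath m i)
colourPath-primitive m i =
  isPrimitive⇒Primitive m _ (proj₂ (∈-filter⁻ (T? ∘ isPrimitive m) {xs = wordsUpTo (m + m)} (∈-lookup i)))

colourPath-injective : ∀ m {i j} → colourPath m i ≡ colourPath m j → i ≡ j
colourPath-injective m =
  lookup-injective (Unique.filter⁺ (T? ∘ isPrimitive m) (wordsUpTo-unique (m + m))) _ _

colourPath-surjective : ∀ m {w} → Primitive m w → ∃ λ i → colourPath m i ≡ w
colourPath-surjective m {w} g = index w∈ , sym (lookup-index w∈)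
  where
  w∈ : w ∈ primitives m
  w∈ = ∈-filter⁺ (T? ∘ isPrimitive m)
         (wordsUpTo-complete (m + m) w (length-bound w (valid g))) (Primitive⇒isPrimitive g)

-- Part 3.  Factorisation at the first diagonal D-step.

split-compare : ∀ {A : Set} {d : A} (w w' : List A) {r r'} → w ++ d ∷ r ≡ w' ++ d ∷ r' →
  (w ≡ w' × r ≡ r') ⊎ (∃ λ t → w' ≡ w ++ d ∷ t) ⊎ (∃ λ t → w ≡ w' ++ d ∷ t)
split-compare []      []       e = inj₁ (refl , proj₂ (∷-injective e))
split-compare []      (x ∷ w') e with refl , _ ← ∷-injective e = inj₂ (inj₁ (w' , refl))
split-compare (x ∷ w) []       e with refl , _ ← ∷-injective e = inj₂ (inj₂ (w , refl))
split-compare (x ∷ w) (y ∷ w') e with refl , e' ← ∷-injective e with split-compare w w' e'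
... | inj₁ (refl , r≡r')    = inj₁ (refl , r≡r')
... | inj₂ (inj₁ (t , refl)) = inj₂ (inj₁ (t , refl))
... | inj₂ (inj₂ (t , refl)) = inj₂ (inj₂ (t , refl))

record FirstDiagonalD (x y : ℕ) (p : List Step) : Set where
  constructor cut
  field
    z           : ℕ
    w r         : List Step
    p≡          : p ≡ w ++ D ∷ r
    w-valid     : T (validFrom z x y w)
    w-diagonals : diagDFrom x y w ≡ 0

firstDiagonalD : ∀ {m k x y} p → T (validFrom m x y p) → diagDFrom x y p ≡ suc k →
                 FirstDiagonalD x y p
firstDiagonalD (E ∷ p) t d with cut z w r refl wv wd ← firstDiagonalD p (proj₂ (∧-split t)) d =
  cut z (E ∷ w) r refl (∧-join (proj₁ (∧-split t)) wv) wd
firstDiagonalD (N ∷ p) t d with cut z w r refl wv wd ← firstDiagonalD p t d =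
  cut z (N ∷ w) r refl wv wd
firstDiagonalD {x = x} {y} (D ∷ p) t d with x ≡ᵇ y in x≡ᵇy
... | true  = cut x [] p refl (∧-join (≡⇒≡ᵇ x x refl) (≡⇒≡ᵇ y x (sym x≡y))) refl
  where x≡y = ≡ᵇ⇒≡ x y (subst T (sym x≡ᵇy) _)
... | false with cut z w r refl wv wd ← firstDiagonalD p t d =
  cut z (D ∷ w) r refl wv
    (trans (cong (λ b → (if b then 1 else 0) + diagDFrom (suc x) (suc y) w) x≡ᵇy) wd)

record Factorisation (m k : ℕ) (p : List Step) : Set where
  constructor factors
  field
    a b          : ℕ
    w r          : List Step
    p≡           : p ≡ w ++ D ∷ r
    m≡           : m ≡ suc (a + b)
    w-primitive  : Primitive a w
    r-valid      : T (validFrom b 0 0 r)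
    r-diagonals  : diagDFrom 0 0 r ≡ k

factorise : ∀ {m k} p → T (validFrom m 0 0 p) → diagDFrom 0 0 p ≡ suc k → Factorisation m k p
factorise {m} {k} p t d with cut a w r refl wv wd ← firstDiagonalD p t d =
  factors a (m ∸ suc a) w r refl m≡ (mkPrimitive wv wd) r-valid r-diagonals
  where
  m≡ : m ≡ suc (a + (m ∸ suc a))
  m≡ = sym (m+[n∸m]≡n (start≤end r (subst T (++-validity w wv) t)))
  r-valid : T (validFrom (m ∸ suc a) 0 0 r)
  r-valid = subst T (D-join-validity w wv) (subst (λ c → T (validFrom c 0 0 (w ++ D ∷ r))) m≡ t)
  r-diagonals : diagDFrom 0 0 r ≡ k
  r-diagonals = suc-injective (begin
    suc (diagDFrom 0 0 r)                      ≡⟨ cong (_+ suc (diagDFrom 0 0 r)) (sym wd) ⟩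
    diagDFrom 0 0 w + suc (diagDFrom 0 0 r)    ≡⟨ sym (D-join-diagonals w wv) ⟩
    diagDFrom 0 0 (w ++ D ∷ r)                 ≡⟨ d ⟩
    suc k                                      ∎)

-- A primitive path followed by a D-step never begins another primitive path:
-- that D-step would lie on the diagonal.
primitive-prefix : ∀ {a b} w {t} → Primitive a w → Primitive b (w ++ D ∷ t) → ⊥
primitive-prefix w {t} g g' with () ← begin
  suc (diagDFrom 0 0 w + diagDFrom 0 0 t)  ≡⟨ sym (+-suc _ _) ⟩
  diagDFrom 0 0 w + suc (diagDFrom 0 0 t)  ≡⟨ sym (D-join-diagonals w (valid g)) ⟩
  diagDFrom 0 0 (w ++ D ∷ t)               ≡⟨ diagonals g' ⟩
  0                                        ∎

factorisation-unique : ∀ {a b} w w' {r r'} → Primitive a w → Primitive b w' →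
                       w ++ D ∷ r ≡ w' ++ D ∷ r' → w ≡ w' × r ≡ r'
factorisation-unique w w' g g' e with split-compare w w' e
... | inj₁ same               = same
... | inj₂ (inj₁ (t , refl)) with () ← primitive-prefix w g g'
... | inj₂ (inj₂ (t , refl)) with () ← primitive-prefix w' g' g

-- Part 4.  Gluing the parts of a coloured composition.

partPath : ColouredPart → List Step
partPath (j , _ , i) = colourPath (j ∸ 1) i

partPath-primitive : ∀ c → Primitive (proj₁ c ∸ 1) (partPath c)
partPath-primitive (j , _ , i) = colourPath-primitive (j ∸ 1) i

-- A coloured part is determined by its path: the size by the endpoint, the
-- colour by injectivity of the enumeration.
partPath-injective : ∀ {c c'} → partPath c ≡ partPath c' → c ≡ c'
partPath-injective {suc a , s≤s z≤n , i} {suc b , s≤s z≤n , j} e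
  with refl ← endpoint-unique {a} {b} (colourPath a i) (valid (colourPath-primitive a i))
                (subst (T ∘ validFrom b 0 0) (sym e) (valid (colourPath-primitive b j)))
  = cong (λ colour → suc a , s≤s z≤n , colour) (colourPath-injective a e)

glue : ∀ {k} → Vec ColouredPart (suc k) → List Step
glue {zero}  (c ∷ [])  = partPath c
glue {suc k} (c ∷ cs) = partPath c ++ D ∷ glue cs

size : ∀ {k} → Vec ColouredPart (suc k) → ℕ
size {zero}  (c ∷ [])  = proj₁ c ∸ 1
size {suc k} (c ∷ cs) = suc (proj₁ c ∸ 1 + size cs)

-- Since every part is positive, the composition sums to size + 1.
sum-parts : ∀ {k} (v : Vec ColouredPart (suc k)) → Vec.sum (Vec.map proj₁ v) ≡ suc (size v)
sum-parts {zero}  ((suc a , _ , _) ∷ [])  = cong suc (+-identityʳ a)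
sum-parts {suc k} ((suc a , _ , _) ∷ cs) = cong suc (trans (cong (a +_) (sum-parts cs)) (+-suc a _))

glue-valid : ∀ {k} (v : Vec ColouredPart (suc k)) → T (validFrom (size v) 0 0 (glue v))
glue-valid {zero}  (c ∷ [])  = valid (partPath-primitive c)
glue-valid {suc k} (c ∷ cs) =
  subst T (sym (D-join-validity (partPath c) (valid (partPath-primitive c))))
    (glue-valid cs)

glue-diagonals : ∀ {k} (v : Vec ColouredPart (suc k)) → diagDFrom 0 0 (glue v) ≡ k
glue-diagonals {zero}  (c ∷ [])  = diagonals (partPath-primitive c)
glue-diagonals {suc k} (c ∷ cs) = begin
  diagDFrom 0 0 (partPath c ++ D ∷ glue cs)
    ≡⟨ D-join-diagonals (partPath c) (valid (partPath-primitive c)) ⟩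
  diagDFrom 0 0 (partPath c) + suc (diagDFrom 0 0 (glue cs))
    ≡⟨ cong₂ (λ u v → u + suc v) (diagonals (partPath-primitive c)) (glue-diagonals cs) ⟩
  suc k
    ∎

-- Unique factorisation makes gluing injective.
glue-injective : ∀ {k} (v v' : Vec ColouredPart (suc k)) → glue v ≡ glue v' → v ≡ v'
glue-injective {zero}  (c ∷ [])  (c' ∷ [])   e = cong (_∷ []) (partPath-injective e)
glue-injective {suc k} (c ∷ cs) (c' ∷ cs') e
  with e₁ , e₂ ← factorisation-unique (partPath c) (partPath c')
                   (partPath-primitive c) (partPath-primitive c') e
  = cong₂ _∷_ (partPath-injective e₁) (glue-injective cs cs' e₂)

-- Repeated factorisation shows every path with k diagonal D-steps is glued.
glue-surjective : ∀ {m} k p → T (validFrom m 0 0 p) → diagDFrom 0 0 p ≡ k →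
                  ∃ λ (v : Vec ColouredPart (suc k)) → glue v ≡ p
glue-surjective {m} zero p t d
  with i , refl ← colourPath-surjective m {p} (mkPrimitive t d) = (suc m , s≤s z≤n , i) ∷ [] , refl
glue-surjective (suc k) p t d
  with factors a _ w r refl _ g r-valid r-diagonals ← factorise p t d
     with i , refl ← colourPath-surjective a {w} g
     with v , refl ← glue-surjective k r r-valid r-diagonals
  = (suc a , s≤s z≤n , i) ∷ v , refl

target-≡ : ∀ {m k p} (t t' : T (validFrom m 0 0 p)) (d d' : diagDFrom 0 0 p ≡ k) →
           _≡_ {A = Σ (SchroderPath m) (λ q → diagD q ≡ k)} ((p , t) , d) ((p , t') , d')
target-≡ t t' d d' with refl ← T-irrelevant t t' | refl ← ≡-irrelevant d d' = refl

compositions⤖paths : ∀ m k → CS (suc m) (suc k) ⤖ Σ (SchroderPath m) (λ p → diagD p ≡ k)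
compositions⤖paths m k = mk⤖ {to = to} (injective , surjective)
  where
  to : CS (suc m) (suc k) → Σ (SchroderPath m) (λ p → diagD p ≡ k)
  to (v , Σv≡) =
    (glue v , subst (λ c → T (validFrom c 0 0 (glue v))) size≡ (glue-valid v)) , glue-diagonals v
    where size≡ = suc-injective (trans (sym (sum-parts v)) Σv≡)

  injective : Injective _≡_ _≡_ to
  injective {v , e} {v' , e'} eq with refl ← glue-injective v v' (cong (proj₁ ∘ proj₁) eq)
                                    with refl ← ≡-irrelevant e e' = refl

  surjective : Surjective _≡_ _≡_ to
  surjective ((p , t) , d) with v , refl ← glue-surjective k p t d =
    (v , trans (sum-parts v) (cong suc (endpoint-unique p (glue-valid v) t))) ,
    λ { refl → target-≡ _ t _ d }

lemma2p1 : (n k : ℕ) → 1 ≤ k →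
    CS (n + k) k ⤖ Σ (SchroderPath (n + k ∸ 1)) (λ p → diagD p ≡ k ∸ 1)
lemma2p1 n zero    ()
lemma2p1 n (suc k) _ rewrite +-suc n k = compositions⤖paths (n + k) k
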